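{- Let $D$ be a strongly connected digraph with girth $g$, and let $T$ be a DFS tree of $D$ rooted at $r$, of length $t$, with generations $V_0,\ldots,V_t$. Let $k=\lceil\frac{t+1}{g-1}\rceil$ and, for each $h\in\{0,\ldots,k-1\}$, let $U_h=\bigcup_{j=0}^{g-2}V_{h(g-1)+j}$, where $V_m=\emptyset$ whenever $m>t$. Then $U_0,\ldots,U_{k-1}$ form a partition of $V(D)$ into acyclic sets. Moreover, there is no backward arc $(u,v)$ of $D$ with both ends in the same $U_h$.
   Context: All digraphs are finite and loopless. Strongly connected: directed path between any ordered pair of distinct vertices. Girth: length of a shortest directed cycle. A DFS tree $T$ of $D$ rooted at $r$ is the spanning out-branching produced by depth-first search on $D$ from $r$. $v$ is a descendant of $u$ if there is a directed $uv$-path in $T$; an arc $(u,v)$ of $D$ is a backward arc (relative to $T$) if $u$ is a descendant of $v$. $P_u$ is the unique directed path in $T$ from $r$ to $u$, $l(P_u)$ its number of arcs; the length of $T$ is $t=\max_u l(P_u)$ and $V_i=\{u: l(P_u)=i\}$. A set of vertices is acyclic if it induces a subdigraph with no directed cycle. -}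

module Defs where

open import Data.Nat using (ℕ; zero; suc; _+_; _*_; _∸_; _≤_; _<_)
open import Data.Nat.DivMod using (_/_)
open import Data.Fin using (Fin)
open import Data.List using (List; []; _∷_; _++_; take; length)
open import Data.List.Membership.Propositional using (_∈_; _∉_)
open import Data.List.Relation.Unary.All using (All)
open import Data.List.Relation.Unary.Unique.Propositional using (Unique)
open import Data.List.Relation.Unary.Linked using (Linked)
open import Data.Product using (Σ; ∃; ∃-syntax; _×_; _,_)
open import Relation.Nullary using (¬_)
open import Relation.Binary.PropositionalEquality using (_≡_; _≢_)
open import Relation.Binary.Construct.Closure.ReflexiveTransitive using (Star)

record Digraph : Set₁ where
  field
    n        : ℕ
    Arc      : Fin n → Fin n → Set
    loopless : ∀ v → ¬ Arc v v

open Digraph public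

Vtx : Digraph → Set
Vtx D = Fin (n D)

-- Strongly connected: a directed path between any ordered pair of
-- distinct vertices (directed walks and paths give the same reachability).
StronglyConnected : Digraph → Set
StronglyConnected D = ∀ (x y : Vtx D) → x ≢ y → Star (Arc D) x y

-- A directed cycle: a nonempty list of pairwise distinct vertices
-- v₀ … v_{ℓ-1} with arcs vᵢ → vᵢ₊₁ and v_{ℓ-1} → v₀.  Its length is ℓ.
IsCycle : (D : Digraph) → List (Vtx D) → Set
IsCycle D c = (c ≢ []) × Unique c × Linked (Arc D) (c ++ take 1 c)

IsGirth : (D : Digraph) → ℕ → Set
IsGirth D g =
  (∃[ c ] (IsCycle D c × length c ≡ g)) ×
  (∀ c → IsCycle D c → g ≤ length c)

Acyclic : (D : Digraph) → (Vtx D → Set) → Set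
Acyclic D U = ∀ c → IsCycle D c → ¬ All U c

-- Depth-first search, as a nondeterministic process.
-- Visit D r S₀ S₁ A : DFS started at the unvisited vertex r, with visited
-- list S₀ beforehand, ends with visited list S₁ and produces tree arcs A.

mutual
  data Visit (D : Digraph) (r : Vtx D) :
         List (Vtx D) → List (Vtx D) → List (Vtx D × Vtx D) → Set where
    visit : ∀ {S₀ S₁ A} → r ∉ S₀ → Children D r (r ∷ S₀) S₁ A →
            Visit D r S₀ S₁ A

  data Children (D : Digraph) (r : Vtx D) :
         List (Vtx D) → List (Vtx D) → List (Vtx D × Vtx D) → Set where
    done : ∀ {S} → (∀ w → Arc D r w → w ∈ S) → Children D r S S []
    step : ∀ {w S₀ S₁ S₂ A₁ A₂} → Arc D r w → w ∉ S₀ →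
           Visit D w S₀ S₁ A₁ → Children D r S₁ S₂ A₂ →
           Children D r S₀ S₂ ((r , w) ∷ (A₁ ++ A₂))

IsDFSTree : (D : Digraph) → Vtx D → List (Vtx D × Vtx D) → Set
IsDFSTree D r A = ∃[ S ] Visit D r [] S A

data TPath {V : Set} (A : List (V × V)) : V → V → ℕ → Set where
  here : ∀ {x} → TPath A x x 0
  next : ∀ {x y z m} → (x , y) ∈ A → TPath A y z m → TPath A x z (suc m)

Level : {V : Set} → List (V × V) → V → V → ℕ → Set
Level A r u i = TPath A r u i

Descendant : {V : Set} → List (V × V) → V → V → Set
Descendant A u v = ∃[ i ] TPath A u v i

BackwardArc : (D : Digraph) → List (Vtx D × Vtx D) → Vtx D → Vtx D → Set
BackwardArc D A u v = Arc D u v × Descendant A v u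

IsTreeLength : {V : Set} → List (V × V) → V → ℕ → Set
IsTreeLength A r t = (∃[ u ] Level A r u t) × (∀ u i → Level A r u i → i ≤ t)

-- Ceiling division ⌈ a / b ⌉ (junk value 0 for b = 0, never used).
⌈_/_⌉ : ℕ → ℕ → ℕ
⌈ a / zero ⌉ = 0
⌈ a / suc b ⌉ = (a + b) / suc b

-- U_h = ⋃_{j=0}^{g-2} V_{h(g-1)+j}  (V_m = ∅ for m > t automatically).
U : {V : Set} → List (V × V) → V → ℕ → ℕ → V → Set
U A r g h u = ∃[ i ] (Level A r u i × h * (g ∸ 1) ≤ i × i ≤ h * (g ∸ 1) + (g ∸ 2))

List⟨Arc⟩ : Digraph → Set
List⟨Arc⟩ D = List (Vtx D × Vtx D)

-- Depth-first search classifies every arc x → y: either y is an ancestor of x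
-- (a backward arc), or y finished before x.  A backward arc with both ends in
-- U_h closes, together with the tree path from its head to its tail, a cycle of
-- length at most g − 1, which the girth forbids.  Hence every arc inside U_h
-- decreases the finishing time, so U_h is acyclic.  Since D is strongly
-- connected, the search reaches every vertex, and the partition property is
-- arithmetic on the levels.
module Submission where

open import Defs
open import Data.Nat using (ℕ; zero; suc; _+_; _*_; _∸_; _≤_; _<_; z≤n; s≤s)
open import Data.Nat.Properties
open import Data.Nat.DivMod using (_/_; _%_; m≡m%n+[m/n]*n; m%n<n; m/n*n≤m; m*n/n≡m; /-monoˡ-≤; m<n*o⇒m/o<n)
open import Data.List using (List; []; _∷_; _++_; take; length)
open import Data.List.Membership.Propositional using (_∈_; _∉_)
open import Data.List.Relation.Binary.Subset.Propositional using (_⊆_)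
open import Data.List.Relation.Unary.Linked using (Linked; [-]; _∷_)
open import Data.Product using (∃-syntax; _×_; _,_; proj₁; proj₂)
open import Data.List.Relation.Unary.All as All using (All; []; _∷_)
open import Data.List.Relation.Unary.All.Properties using (++⁺)
open import Data.List.Relation.Unary.AllPairs using ([]; _∷_)
open import Data.List.Relation.Unary.Unique.Propositional using (Unique)
open import Relation.Binary.Construct.Closure.ReflexiveTransitive using (Star; ε; _◅_)
open import Relation.Binary.PropositionalEquality using (_≡_; _≢_; refl; sym; trans; cong; subst)
open import Relation.Nullary using (¬_; contradiction; does; yes; no)
open import Relation.Nullary.Decidable using (dec-true; dec-false)
open import Data.Bool using (if_then_else_)
open import Data.Fin.Properties using () renaming (_≟_ to _≟ᶠ_)
open import Data.Sum using (_⊎_; inj₁; inj₂; [_,_])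
import Data.Sum as Sum
import Data.Product as Product
open import Function using (id; _∘_)
open import Data.List.Relation.Unary.Any using (here; there; toSum)
open import Data.List.Membership.Propositional.Properties using (∈-++⁺ˡ; ∈-++⁺ʳ; ∈-++⁻)

module _ {V : Set} {A : List (V × V)} where

  TPath-trans : ∀ {x y z a b} → TPath A x y a → TPath A y z b → TPath A x z (a + b)
  TPath-trans here q = q
  TPath-trans (next e p) q = next e (TPath-trans p q)

  TPath-unsnoc : ∀ {x z m} → TPath A x z (suc m) → ∃[ y ] (TPath A x y m × (y , z) ∈ A)
  TPath-unsnoc (next e here) = _ , here , e
  TPath-unsnoc (next e p@(next _ _)) with TPath-unsnoc p
  ... | y , q , e′ = y , next e q , e′

  TPath-prefix : ∀ {x z m} → TPath A x z m → ∀ j → j ≤ m → ∃[ y ] TPath A x y j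
  TPath-prefix p zero _ = _ , here
  TPath-prefix (next e p) (suc j) (s≤s j≤m) with TPath-prefix p j j≤m
  ... | y , q = y , next e q

  Orphan : V → Set
  Orphan r = ∀ {a} → (a , r) ∉ A

  UniqueParents : Set
  UniqueParents = ∀ {a a′ b} → (a , b) ∈ A → (a′ , b) ∈ A → a ≡ a′

  TPath-length-unique : ∀ {r} → Orphan r → UniqueParents →
                        ∀ {z m m′} → TPath A r z m → TPath A r z m′ → m ≡ m′
  TPath-length-unique {r} orphan unique = go _ _
    where
    go : ∀ {z} m m′ → TPath A r z m → TPath A r z m′ → m ≡ m′
    go zero zero _ _ = refl
    go zero (suc m′) here q with TPath-unsnoc q
    ... | _ , _ , e = contradiction e orphan
    go (suc m) zero p here with TPath-unsnoc p
    ... | _ , _ , e = contradiction e orphan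
    go (suc m) (suc m′) p q with TPath-unsnoc p | TPath-unsnoc q
    ... | _ , p′ , e | _ , q′ , e′ with unique e e′
    ... | refl = cong suc (go m m′ p′ q′)

  targets : ∀ {x z m} → TPath A x z m → List V
  targets here = []
  targets (next {y = y} _ p) = y ∷ targets p

  length-targets : ∀ {x z m} (p : TPath A x z m) → length (targets p) ≡ m
  length-targets here = refl
  length-targets (next _ p) = cong suc (length-targets p)

  TPath-linked : ∀ (R : V → V → Set) → (∀ {a b} → (a , b) ∈ A → R a b) →
                 ∀ {x z m w} (p : TPath A x z m) → R z w → Linked R (x ∷ targets p ++ w ∷ [])
  TPath-linked R arc here zRw = zRw ∷ [-]
  TPath-linked R arc (next e p) zRw = arc e ∷ TPath-linked R arc p zRw

TPath-mono : ∀ {V} {A B : List (V × V)} → A ⊆ B → ∀ {x z m} → TPath A x z m → TPath B x z m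
TPath-mono A⊆B here = here
TPath-mono A⊆B (next e p) = next (A⊆B e) (TPath-mono A⊆B p)

Descendant-mono : ∀ {V} {A B : List (V × V)} → A ⊆ B → ∀ {x z} → Descendant A x z → Descendant B x z
Descendant-mono A⊆B (m , p) = m , TPath-mono A⊆B p

<⌈/⌉⇒*< : ∀ m n d → m < ⌈ n / suc d ⌉ → m * suc d < n
<⌈/⌉⇒*< m n d m<⌈n/d⌉ = +-cancelˡ-≤ d _ _ (begin
  d + suc (m * suc d)          ≡⟨ +-suc d (m * suc d) ⟩
  suc m * suc d                ≤⟨ *-monoˡ-≤ (suc d) m<⌈n/d⌉ ⟩
  (n + d) / suc d * suc d      ≤⟨ m/n*n≤m (n + d) (suc d) ⟩
  n + d                        ≡⟨ +-comm n d ⟩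
  d + n                        ∎)
  where open ≤-Reasoning

*<⇒<⌈/⌉ : ∀ m n d → m * suc d < n → m < ⌈ n / suc d ⌉
*<⇒<⌈/⌉ m n d m*d<n = begin
  suc m                        ≡⟨ m*n/n≡m (suc m) (suc d) ⟨
  suc m * suc d / suc d        ≤⟨ /-monoˡ-≤ (suc d) sm*d≤n+d ⟩
  (n + d) / suc d              ∎
  where
  open ≤-Reasoning
  sm*d≤n+d : suc m * suc d ≤ n + d
  sm*d≤n+d = begin
    suc m * suc d              ≡⟨ +-suc d (m * suc d) ⟨
    d + suc (m * suc d)        ≤⟨ +-monoʳ-≤ d m*d<n ⟩
    d + n                      ≡⟨ +-comm d n ⟩
    n + d                      ∎

m≤m/n*n+[n∸1] : ∀ m d → m ≤ m / suc d * suc d + d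
m≤m/n*n+[n∸1] m d = begin
  m                            ≡⟨ m≡m%n+[m/n]*n m (suc d) ⟩
  m % suc d + m / suc d * suc d ≤⟨ +-monoˡ-≤ _ (m<1+n⇒m≤n (m%n<n m (suc d))) ⟩
  d + m / suc d * suc d        ≡⟨ +-comm d _ ⟩
  m / suc d * suc d + d        ∎
  where open ≤-Reasoning

/-unique : ∀ {h m d} → h * suc d ≤ m → m ≤ h * suc d + d → m / suc d ≡ h
/-unique {h} {m} {d} lo hi = ≤-antisym (m<1+n⇒m≤n (m<n*o⇒m/o<n m<[1+h]*d)) (begin
  h                            ≡⟨ m*n/n≡m h (suc d) ⟨
  h * suc d / suc d            ≤⟨ /-monoˡ-≤ (suc d) lo ⟩
  m / suc d                    ∎)
  where
  open ≤-Reasoning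
  m<[1+h]*d : m < suc h * suc d
  m<[1+h]*d = s≤s (≤-trans hi (≤-reflexive (+-comm (h * suc d) d)))

girth≥2 : ∀ {D g} → IsGirth D g → 2 ≤ g
girth≥2 {D} ((c , (c≢[] , _ , linked) , refl) , _) = go c c≢[] linked
  where
  go : ∀ c → c ≢ [] → Linked (Arc D) (c ++ take 1 c) → 2 ≤ length c
  go [] c≢[] _ = contradiction refl c≢[]
  go (x ∷ []) _ (x→x ∷ _) = contradiction x→x (loopless D x)
  go (_ ∷ _ ∷ _) _ _ = s≤s (s≤s z≤n)

module DepthFirstSearch (D : Digraph) where

  private
    V = Vtx D

  open import Data.List.Membership.DecPropositional (_≟ᶠ_ {n D}) using (_∈?_)

  ∉-∷ : ∀ {x r : V} {S} → x ≢ r → x ∉ S → x ∉ r ∷ S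
  ∉-∷ x≢r x∉S = [ x≢r , x∉S ] ∘ toSum

  -- rank is a finishing time of the run from S₀ to S₁: an arc leaving a newly
  -- visited vertex goes to a vertex visited before the run, to an ancestor, or
  -- to a vertex finished earlier.
  record Explored (S₀ S₁ : List V) (A : List (V × V)) : Set where
    field
      grows         : S₀ ⊆ S₁
      closed        : ∀ {x y} → x ∈ S₁ → x ∉ S₀ → Arc D x y → y ∈ S₁
      tree-arc      : ∀ {a b} → (a , b) ∈ A → Arc D a b
      tree-target   : ∀ {a b} → (a , b) ∈ A → b ∈ S₁ × b ∉ S₀
      unique-parent : UniqueParents {A = A}
      rank          : V → ℕ
      rank-bound    : ℕ
      rank<bound    : ∀ {x} → x ∈ S₁ → x ∉ S₀ → rank x < rank-bound
      arc-rank      : ∀ {x y} → x ∈ S₁ → x ∉ S₀ → Arc D x y →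
                      y ∈ S₀ ⊎ (y ∉ S₀ × rank y < rank x) ⊎ Descendant A y x

  Explored-refl : ∀ {S} → Explored S S []
  Explored-refl = record
    { grows = id
    ; closed = λ x∈S x∉S _ → contradiction x∈S x∉S
    ; tree-arc = λ ()
    ; tree-target = λ ()
    ; unique-parent = λ ()
    ; rank = λ _ → 0
    ; rank-bound = 0
    ; rank<bound = λ x∈S x∉S → contradiction x∈S x∉S
    ; arc-rank = λ x∈S x∉S _ → contradiction x∈S x∉S
    }

  Explored-trans : ∀ {S₀ S₁ S₂ A₁ A₂} → Explored S₀ S₁ A₁ → Explored S₁ S₂ A₂ →
                   Explored S₀ S₂ (A₁ ++ A₂)
  Explored-trans {S₀} {S₁} {S₂} {A₁} {A₂} E₁ E₂ = record
    { grows = E₂.grows ∘ E₁.grows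
    ; closed = closed
    ; tree-arc = [ E₁.tree-arc , E₂.tree-arc ] ∘ ∈-++⁻ A₁
    ; tree-target = tree-target
    ; unique-parent = unique-parent
    ; rank = rank
    ; rank-bound = E₁.rank-bound + E₂.rank-bound
    ; rank<bound = rank<bound
    ; arc-rank = arc-rank
    }
    where
    module E₁ = Explored E₁
    module E₂ = Explored E₂
    rank : V → ℕ
    rank x = if does (x ∈? S₁) then E₁.rank x else E₁.rank-bound + E₂.rank x
    rank-old : ∀ {x} → x ∈ S₁ → rank x ≡ E₁.rank x
    rank-old {x} x∈S₁ rewrite dec-true (x ∈? S₁) x∈S₁ = refl
    rank-new : ∀ {x} → x ∉ S₁ → rank x ≡ E₁.rank-bound + E₂.rank x
    rank-new {x} x∉S₁ rewrite dec-false (x ∈? S₁) x∉S₁ = refl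
    closed : ∀ {x y} → x ∈ S₂ → x ∉ S₀ → Arc D x y → y ∈ S₂
    closed {x} x∈S₂ x∉S₀ x→y with x ∈? S₁
    ... | yes x∈S₁ = E₂.grows (E₁.closed x∈S₁ x∉S₀ x→y)
    ... | no x∉S₁ = E₂.closed x∈S₂ x∉S₁ x→y
    tree-target : ∀ {a b} → (a , b) ∈ A₁ ++ A₂ → b ∈ S₂ × b ∉ S₀
    tree-target e with ∈-++⁻ A₁ e
    ... | inj₁ e₁ = Product.map₁ E₂.grows (E₁.tree-target e₁)
    ... | inj₂ e₂ = Product.map₂ (_∘ E₁.grows) (E₂.tree-target e₂)
    unique-parent : UniqueParents {A = A₁ ++ A₂}
    unique-parent e e′ with ∈-++⁻ A₁ e | ∈-++⁻ A₁ e′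
    ... | inj₁ e₁ | inj₁ e₁′ = E₁.unique-parent e₁ e₁′
    ... | inj₂ e₂ | inj₂ e₂′ = E₂.unique-parent e₂ e₂′
    ... | inj₁ e₁ | inj₂ e₂′ = contradiction (proj₁ (E₁.tree-target e₁)) (proj₂ (E₂.tree-target e₂′))
    ... | inj₂ e₂ | inj₁ e₁′ = contradiction (proj₁ (E₁.tree-target e₁′)) (proj₂ (E₂.tree-target e₂))
    rank<bound : ∀ {x} → x ∈ S₂ → x ∉ S₀ → rank x < E₁.rank-bound + E₂.rank-bound
    rank<bound {x} x∈S₂ x∉S₀ with x ∈? S₁
    ... | yes x∈S₁ = <-≤-trans (E₁.rank<bound x∈S₁ x∉S₀) (m≤m+n _ _)
    ... | no x∉S₁ = +-monoʳ-< E₁.rank-bound (E₂.rank<bound x∈S₂ x∉S₁)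
    arc-rank : ∀ {x y} → x ∈ S₂ → x ∉ S₀ → Arc D x y →
               y ∈ S₀ ⊎ (y ∉ S₀ × rank y < rank x) ⊎ Descendant (A₁ ++ A₂) y x
    arc-rank {x} {y} x∈S₂ x∉S₀ x→y with x ∈? S₁
    ... | yes x∈S₁ with E₁.arc-rank x∈S₁ x∉S₀ x→y
    ...   | inj₁ y∈S₀ = inj₁ y∈S₀
    ...   | inj₂ (inj₁ (y∉S₀ , lt)) = inj₂ (inj₁ (y∉S₀ ,
            subst (_< E₁.rank x) (sym (rank-old (E₁.closed x∈S₁ x∉S₀ x→y))) lt))
    ...   | inj₂ (inj₂ desc) = inj₂ (inj₂ (Descendant-mono ∈-++⁺ˡ desc))
    arc-rank {x} {y} x∈S₂ x∉S₀ x→y | no x∉S₁ with E₂.arc-rank x∈S₂ x∉S₁ x→y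
    ... | inj₂ (inj₁ (y∉S₁ , lt)) = inj₂ (inj₁ (y∉S₁ ∘ E₁.grows ,
          subst (_< E₁.rank-bound + E₂.rank x) (sym (rank-new y∉S₁)) (+-monoʳ-< E₁.rank-bound lt)))
    ... | inj₂ (inj₂ desc) = inj₂ (inj₂ (Descendant-mono (∈-++⁺ʳ A₁) desc))
    ... | inj₁ y∈S₁ with y ∈? S₀
    ...   | yes y∈S₀ = inj₁ y∈S₀
    ...   | no y∉S₀ = inj₂ (inj₁ (y∉S₀ ,
            subst (_< E₁.rank-bound + E₂.rank x) (sym (rank-old y∈S₁))
              (<-≤-trans (E₁.rank<bound y∈S₁ y∉S₀) (m≤m+n _ _))))

  Explored-graft : ∀ {r w S₀ S₁ A} → Arc D r w → w ∈ S₁ → w ∉ S₀ → Orphan {A = A} w →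
                   Explored S₀ S₁ A → Explored S₀ S₁ ((r , w) ∷ A)
  Explored-graft {r} {w} {S₀} {S₁} {A} r→w w∈S₁ w∉S₀ orphan E = record
    { grows = E.grows
    ; closed = E.closed
    ; tree-arc = λ { (here refl) → r→w ; (there e) → E.tree-arc e }
    ; tree-target = λ { (here refl) → w∈S₁ , w∉S₀ ; (there e) → E.tree-target e }
    ; unique-parent = unique-parent
    ; rank = E.rank
    ; rank-bound = E.rank-bound
    ; rank<bound = E.rank<bound
    ; arc-rank = λ x∈S₁ x∉S₀ x→y →
        Sum.map₂ (Sum.map₂ (Descendant-mono there)) (E.arc-rank x∈S₁ x∉S₀ x→y)
    }
    where
    module E = Explored E
    unique-parent : UniqueParents {A = (r , w) ∷ A}
    unique-parent (here refl) (here refl) = refl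
    unique-parent (here refl) (there e′) = contradiction e′ orphan
    unique-parent (there e) (here refl) = contradiction e orphan
    unique-parent (there e) (there e′) = E.unique-parent e e′

  -- Once all out-neighbours of r are visited, r finishes last.
  Explored-close : ∀ {r S₀ S₁ A} → r ∉ S₀ → (∀ {y} → Arc D r y → y ∈ S₁) →
                   (∀ {x} → x ∈ S₁ → x ∉ r ∷ S₀ → Descendant A r x) →
                   Explored (r ∷ S₀) S₁ A → Explored S₀ S₁ A
  Explored-close {r} {S₀} {S₁} {A} r∉S₀ out-visited spanned E = record
    { grows = E.grows ∘ there
    ; closed = closed
    ; tree-arc = E.tree-arc
    ; tree-target = Product.map₂ (_∘ there) ∘ E.tree-target
    ; unique-parent = E.unique-parent
    ; rank = rank
    ; rank-bound = suc E.rank-bound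
    ; rank<bound = rank<bound
    ; arc-rank = arc-rank
    }
    where
    module E = Explored E
    rank : V → ℕ
    rank x = if does (x ≟ᶠ r) then E.rank-bound else E.rank x
    rank-other : ∀ {x} → x ≢ r → rank x ≡ E.rank x
    rank-other {x} x≢r rewrite dec-false (x ≟ᶠ r) x≢r = refl
    closed : ∀ {x y} → x ∈ S₁ → x ∉ S₀ → Arc D x y → y ∈ S₁
    closed {x} x∈S₁ x∉S₀ x→y with x ≟ᶠ r
    ... | yes refl = out-visited x→y
    ... | no x≢r = E.closed x∈S₁ (∉-∷ x≢r x∉S₀) x→y
    rank<bound : ∀ {x} → x ∈ S₁ → x ∉ S₀ → rank x < suc E.rank-bound
    rank<bound {x} x∈S₁ x∉S₀ with x ≟ᶠ r
    ... | yes refl = n<1+n E.rank-bound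
    ... | no x≢r = m<n⇒m<1+n (E.rank<bound x∈S₁ (∉-∷ x≢r x∉S₀))
    arc-rank : ∀ {x y} → x ∈ S₁ → x ∉ S₀ → Arc D x y →
               y ∈ S₀ ⊎ (y ∉ S₀ × rank y < rank x) ⊎ Descendant A y x
    arc-rank {x} {y} x∈S₁ x∉S₀ x→y with x ≟ᶠ r
    ... | yes refl with y ∈? S₀
    ...   | yes y∈S₀ = inj₁ y∈S₀
    ...   | no y∉S₀ = inj₂ (inj₁ (y∉S₀ , subst (_< E.rank-bound) (sym (rank-other y≢x))
            (E.rank<bound (out-visited x→y) (∉-∷ y≢x y∉S₀))))
      where
      y≢x : y ≢ x
      y≢x refl = loopless D y x→y
    arc-rank {x} {y} x∈S₁ x∉S₀ x→y | no x≢r with E.arc-rank x∈S₁ (∉-∷ x≢r x∉S₀) x→y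
    ... | inj₁ (here refl) = inj₂ (inj₂ (spanned x∈S₁ (∉-∷ x≢r x∉S₀)))
    ... | inj₁ (there y∈S₀) = inj₁ y∈S₀
    ... | inj₂ (inj₁ (y∉rS₀ , lt)) = inj₂ (inj₁ (y∉rS₀ ∘ there ,
          subst (_< E.rank x) (sym (rank-other (y∉rS₀ ∘ here))) lt))
    ... | inj₂ (inj₂ desc) = inj₂ (inj₂ desc)

  record ChildrenInvariant (r : V) (S₀ S₁ : List V) (A : List (V × V)) : Set where
    field
      explored    : Explored S₀ S₁ A
      out-visited : ∀ {y} → Arc D r y → y ∈ S₁
      spanned     : ∀ {x} → x ∈ S₁ → x ∉ S₀ → Descendant A r x

  record VisitInvariant (r : V) (S₀ S₁ : List V) (A : List (V × V)) : Set where
    field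
      explored    : Explored S₀ S₁ A
      visited     : r ∈ S₁
      root-orphan : Orphan {A = A} r
      spanned     : ∀ {x} → x ∈ S₁ → x ∉ S₀ → Descendant A r x

  visit-invariant : ∀ {r S₀ S₁ A} → r ∉ S₀ → ChildrenInvariant r (r ∷ S₀) S₁ A →
                    VisitInvariant r S₀ S₁ A
  visit-invariant {r} {S₀} {S₁} {A} r∉S₀ C = record
    { explored = Explored-close r∉S₀ C.out-visited C.spanned C.explored
    ; visited = Explored.grows C.explored (here refl)
    ; root-orphan = λ e → proj₂ (Explored.tree-target C.explored e) (here refl)
    ; spanned = spanned
    }
    where
    module C = ChildrenInvariant C
    spanned : ∀ {x} → x ∈ S₁ → x ∉ S₀ → Descendant A r x
    spanned {x} x∈S₁ x∉S₀ with x ≟ᶠ r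
    ... | yes refl = 0 , here
    ... | no x≢r = C.spanned x∈S₁ (∉-∷ x≢r x∉S₀)

  children-step : ∀ {r w S₀ S₁ S₂ A₁ A₂} → Arc D r w → w ∉ S₀ →
                  VisitInvariant w S₀ S₁ A₁ → ChildrenInvariant r S₁ S₂ A₂ →
                  ChildrenInvariant r S₀ S₂ ((r , w) ∷ A₁ ++ A₂)
  children-step {r} {w} {S₀} {S₁} {S₂} {A₁} {A₂} r→w w∉S₀ W C = record
    { explored = Explored-graft r→w (Explored.grows C.explored W.visited) w∉S₀ orphan
                   (Explored-trans W.explored C.explored)
    ; out-visited = C.out-visited
    ; spanned = spanned
    }
    where
    module W = VisitInvariant W
    module C = ChildrenInvariant C
    orphan : Orphan {A = A₁ ++ A₂} w
    orphan e with ∈-++⁻ A₁ e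
    ... | inj₁ e₁ = W.root-orphan e₁
    ... | inj₂ e₂ = proj₂ (Explored.tree-target C.explored e₂) W.visited
    spanned : ∀ {x} → x ∈ S₂ → x ∉ S₀ → Descendant ((r , w) ∷ A₁ ++ A₂) r x
    spanned {x} x∈S₂ x∉S₀ with x ∈? S₁
    ... | yes x∈S₁ with W.spanned x∈S₁ x∉S₀
    ...   | m , w⇝x = suc m , next (here refl) (TPath-mono (there ∘ ∈-++⁺ˡ) w⇝x)
    spanned {x} x∈S₂ x∉S₀ | no x∉S₁ =
      Descendant-mono (there ∘ ∈-++⁺ʳ A₁) (C.spanned x∈S₂ x∉S₁)

  mutual
    Visit⇒invariant : ∀ {r S₀ S₁ A} → Visit D r S₀ S₁ A → VisitInvariant r S₀ S₁ A
    Visit⇒invariant (visit r∉S₀ children) = visit-invariant r∉S₀ (Children⇒invariant children)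

    Children⇒invariant : ∀ {r S₀ S₁ A} → Children D r S₀ S₁ A → ChildrenInvariant r S₀ S₁ A
    Children⇒invariant (done out-visited) = record
      { explored = Explored-refl
      ; out-visited = out-visited _
      ; spanned = λ x∈S x∉S → contradiction x∈S x∉S
      }
    Children⇒invariant (step r→w w∉S₀ v c) =
      children-step r→w w∉S₀ (Visit⇒invariant v) (Children⇒invariant c)

-- The girth is written b + 2, so each layer spans b + 1 = g − 1 levels.
module Layering (D : Digraph) (strong : StronglyConnected D)
                (b : ℕ) (girth : IsGirth D (suc (suc b)))
                (r : Vtx D) (T : List⟨Arc⟩ D) {S : List (Vtx D)} (dfs : Visit D r [] S T)
                (t : ℕ) (tree-length : IsTreeLength T r t) where

  open DepthFirstSearch D
  open VisitInvariant (Visit⇒invariant dfs)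
  open Explored explored

  k : ℕ
  k = ⌈ (t + 1) / suc b ⌉

  Layer : ℕ → Vtx D → Set
  Layer = U T r (suc (suc b))

  reach-visited : ∀ {x y} → x ∈ S → Star (Arc D) x y → y ∈ S
  reach-visited x∈S ε = x∈S
  reach-visited x∈S (x→y ◅ y⇝z) = reach-visited (closed x∈S (λ ()) x→y) y⇝z

  all-visited : ∀ u → u ∈ S
  all-visited u with u ≟ᶠ r
  ... | yes refl = visited
  ... | no u≢r = reach-visited visited (strong r u (u≢r ∘ sym))

  depth : ∀ u → ∃[ i ] Level T r u i
  depth u = spanned (all-visited u) (λ ())

  Level-unique : ∀ {u i j} → Level T r u i → Level T r u j → i ≡ j
  Level-unique = TPath-length-unique root-orphan unique-parent

  arc-classification : ∀ {x y} → Arc D x y → rank y < rank x ⊎ Descendant T y x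
  arc-classification x→y with arc-rank (all-visited _) (λ ()) x→y
  ... | inj₁ ()
  ... | inj₂ (inj₁ (_ , lt)) = inj₁ lt
  ... | inj₂ (inj₂ desc) = inj₂ desc

  deeper-along : ∀ {x z m c} (p : TPath T x z m) → Level T r x c →
                 All (λ w → ∃[ d ] (c < d × Level T r w d)) (targets p)
  deeper-along here _ = []
  deeper-along {c = c} (next e p) x∈Vc =
    (c + 1 , c<c+1 , y∈V) ∷ All.map (λ (d , lt , w∈Vd) → d , <-trans c<c+1 lt , w∈Vd) (deeper-along p y∈V)
    where
    y∈V = TPath-trans x∈Vc (next e here)
    c<c+1 = m<m+n c (s≤s z≤n)

  TPath-unique-vertices : ∀ {x z m c} (p : TPath T x z m) → Level T r x c → Unique (x ∷ targets p)
  TPath-unique-vertices here _ = [] ∷ []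
  TPath-unique-vertices (next e p) x∈Vc =
    All.map (λ { (d , c<d , w∈Vd) refl → <-irrefl (Level-unique x∈Vc w∈Vd) c<d }) (deeper-along (next e p) x∈Vc)
    ∷ TPath-unique-vertices p (TPath-trans x∈Vc (next e here))

  backward-cycle : ∀ {u v i} → Arc D u v → (p : TPath T v u i) → IsCycle D (v ∷ targets p)
  backward-cycle u→v p = (λ ()) , TPath-unique-vertices p (proj₂ (depth _)) , TPath-linked (Arc D) tree-arc p u→v

  backward-arc-span : ∀ {u v i} → Arc D u v → TPath T v u i → suc b ≤ i
  backward-arc-span u→v p =
    ≤-pred (subst (suc (suc b) ≤_) (cong suc (length-targets p)) (proj₂ girth _ (backward-cycle u→v p)))

  no-backward-arc-in-layer : ∀ h {u v} → Layer h u → Layer h v → ¬ BackwardArc D T u v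
  no-backward-arc-in-layer h (i , u∈Vi , _ , i≤top) (j , v∈Vj , bottom≤j , _) (u→v , l , v⇝u) =
    ≤⇒≯ l≤b (backward-arc-span u→v v⇝u)
    where
    open ≤-Reasoning
    l≤b : l ≤ b
    l≤b = +-cancelˡ-≤ (h * suc b) l b (begin
      h * suc b + l  ≤⟨ +-monoˡ-≤ l bottom≤j ⟩
      j + l          ≡⟨ Level-unique (TPath-trans v∈Vj v⇝u) u∈Vi ⟩
      i              ≤⟨ i≤top ⟩
      h * suc b + b  ∎)

  layer-arc-rank : ∀ h {x y} → Layer h x → Layer h y → Arc D x y → rank y < rank x
  layer-arc-rank h x∈U y∈U x→y with arc-classification x→y
  ... | inj₁ lt = lt
  ... | inj₂ desc = contradiction (x→y , desc) (no-backward-arc-in-layer h x∈U y∈U)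

  rank-falls-along : ∀ h {x} xs → Linked (Arc D) (x ∷ xs) → All (Layer h) (x ∷ xs) →
                     All (λ z → rank z < rank x) xs
  rank-falls-along h [] _ _ = []
  rank-falls-along h (y ∷ ys) (x→y ∷ linked) (x∈U ∷ y∈U ∷ ys∈U) =
    y<x ∷ All.map (λ z<y → <-trans z<y y<x) (rank-falls-along h ys linked (y∈U ∷ ys∈U))
    where y<x = layer-arc-rank h x∈U y∈U x→y

  layer-acyclic : ∀ h → Acyclic D (Layer h)
  layer-acyclic h [] (c≢[] , _) _ = c≢[] refl
  layer-acyclic h (x ∷ c) (_ , _ , linked) (x∈U ∷ c∈U) =
    <-irrefl refl (All.lookup (rank-falls-along h (c ++ x ∷ []) linked (x∈U ∷ ++⁺ c∈U (x∈U ∷ []))) (∈-++⁺ʳ c (here refl)))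

  layers-cover : ∀ u → ∃[ h ] (h < k × Layer h u)
  layers-cover u with depth u
  ... | i , u∈Vi = i / suc b , *<⇒<⌈/⌉ (i / suc b) (t + 1) b (≤-<-trans i/d*d≤i (m<m+n t (s≤s z≤n))) ,
                   i , u∈Vi , m/n*n≤m i (suc b) , m≤m/n*n+[n∸1] i b
    where i/d*d≤i = ≤-trans (m/n*n≤m i (suc b)) (proj₂ tree-length u i u∈Vi)

  layer-unique : ∀ h h′ {u} → Layer h u → Layer h′ u → h ≡ h′
  layer-unique h h′ (i , u∈Vi , lo , hi) (i′ , u∈Vi′ , lo′ , hi′) with Level-unique u∈Vi u∈Vi′
  ... | refl = trans (sym (/-unique lo hi)) (/-unique lo′ hi′)

  layer-nonempty : ∀ h → h < k → ∃[ u ] Layer h u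
  layer-nonempty h h<k with proj₁ tree-length
  ... | w , w∈Vt with TPath-prefix w∈Vt (h * suc b) (m<1+n⇒m≤n (subst (h * suc b <_) (+-comm t 1) (<⌈/⌉⇒*< h (t + 1) b h<k)))
  ...   | u , u∈V = u , h * suc b , u∈V , ≤-refl , m≤m+n (h * suc b) b

lemma7 : (D : Digraph) → StronglyConnected D →
         (g : ℕ) → IsGirth D g →
         (r : Vtx D) (T : List⟨Arc⟩ D) → IsDFSTree D r T →
         (t : ℕ) → IsTreeLength T r t →
         let k = ⌈ (t + 1) / (g ∸ 1) ⌉ in
         -- U_0 … U_{k-1} partition V(D)
         (∀ u → ∃[ h ] (h < k × U T r g h u)) ×
         (∀ u h h′ → h < k → h′ < k → U T r g h u → U T r g h′ u → h ≡ h′) ×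
         (∀ h → h < k → ∃[ u ] U T r g h u) ×
         -- each U_h is acyclic
         (∀ h → h < k → Acyclic D (U T r g h)) ×
         -- no backward arc with both ends in the same U_h
         (∀ h u v → h < k → U T r g h u → U T r g h v → ¬ BackwardArc D T u v)
lemma7 D _ zero girth = contradiction (girth≥2 {D} girth) λ ()
lemma7 D _ (suc zero) girth = contradiction (girth≥2 {D} girth) λ { (s≤s ()) }
lemma7 D strong (suc (suc b)) girth r T (_ , dfs) t tree-length =
  layers-cover ,
  (λ _ h h′ _ _ → layer-unique h h′) ,
  layer-nonempty ,
  (λ h _ → layer-acyclic h) ,
  (λ h _ _ _ → no-backward-arc-in-layer h)
  where open Layering D strong b girth r T dfs t tree-length
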